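{- Let $g\ge3$ and $2\le k<g$ be integers such that the $(g,k)$ Young graph exists. Then no two distinct edges of the Young graph, among the edges that do not leave the starting node, carry the same label.
   Context: Young graph. The directed edge-labelled graph $H(g,k)$ is defined as follows. Its possible nodes are a distinguished starting node, written $[[0,0]]$, and ordered pairs $[s,r]$ of integers with $0\le s,r\le k-1$ (the pair $[0,0]$ is a node distinct from the starting node). For a node $[s,r]$ (the starting node being treated as $s=r=0$) and each pair of digits $(c,a)$, $0\le a,c\le g-1$, with $ka+r\equiv c \pmod g$ and $0\le a+sg-kc\le k-1$, there is a directed edge labelled $(c,a)$ from $[s,r]$ to the node $[\,a+sg-kc,\ (ka+r-c)/g\,]$; for edges leaving the starting node one additionally requires $a\ne0$ and $c\ne0$. $H(g,k)$ consists of the starting node, the nodes reachable from it by directed paths, and all edges leaving these nodes. A non-starting node of the form $[r,r]$ ($r\ge0$, including $[0,0]$) is an even pivot node; a non-starting node is an odd pivot node if it is of the form $[r,r]$ and carries a loop, or is of the form $[r',r]$ with $r'\ne r$ and has an edge to $[r,r']$. The $(g,k)$ Young graph exists if $H(g,k)$ contains a node $[r,r]$ with $r\ne0$ or an edge $[r',r]\to[r,r']$ with $r'\ne r$; it is then obtained from $H(g,k)$ by deleting every node from which no pivot node can be reached by a directed path, together with all edges incident to such nodes. -}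

module Defs where

open import Data.Nat using (ℕ; _<_)
open import Data.Integer as ℤ using (ℤ; +_)
open import Data.Integer.Divisibility using () renaming (_∣_ to _∣ℤ_)
open import Data.Product using (Σ; _×_; ∃; ∃₂; _,_)
open import Data.Sum using (_⊎_)
open import Data.Unit using (⊤)
open import Relation.Nullary using (¬_)
open import Relation.Binary.PropositionalEquality using (_≡_; _≢_)
open import Relation.Binary.Construct.Closure.ReflexiveTransitive using (Star)

-- Possible nodes of H(g,k): the distinguished starting node [[0,0]],
-- and pairs [s,r] (distinct from the starting node).
data Node : Set where
  start : Node
  ⟦_,_⟧ : ℕ → ℕ → Node

sOf : Node → ℕ
sOf start = 0
sOf ⟦ s , r ⟧ = s

rOf : Node → ℕ
rOf start = 0
rOf ⟦ s , r ⟧ = r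

StartCond : Node → ℕ → ℕ → Set
StartCond start c a = (c ≢ 0) × (a ≢ 0)
StartCond ⟦ _ , _ ⟧ c a = ⊤

data Edge (g k : ℕ) : Node → ℕ → ℕ → Node → Set where
  edge : ∀ {u c a s' r'} →
         a < g → c < g →
         (+ g) ∣ℤ ((+ k ℤ.* + a ℤ.+ + rOf u) ℤ.- + c) →
         + s' ≡ (+ a ℤ.+ + sOf u ℤ.* + g) ℤ.- + k ℤ.* + c →
         s' < k →
         + g ℤ.* + r' ≡ (+ k ℤ.* + a ℤ.+ + rOf u) ℤ.- + c →
         r' < k →
         StartCond u c a →
         Edge g k u c a ⟦ s' , r' ⟧

Step : ℕ → ℕ → Node → Node → Set
Step g k u v = ∃₂ λ c a → Edge g k u c a v

Path : ℕ → ℕ → Node → Node → Set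
Path g k = Star (Step g k)

InH : ℕ → ℕ → Node → Set
InH g k v = Path g k start v

EvenPivot : ℕ → ℕ → Node → Set
EvenPivot g k v = InH g k v × ∃ λ r → v ≡ ⟦ r , r ⟧

OddPivot : ℕ → ℕ → Node → Set
OddPivot g k v = InH g k v ×
  ((∃ λ r → v ≡ ⟦ r , r ⟧ × Step g k v v)
   ⊎ (∃₂ λ r' r → v ≡ ⟦ r' , r ⟧ × r' ≢ r × Step g k v ⟦ r , r' ⟧))

Pivot : ℕ → ℕ → Node → Set
Pivot g k v = EvenPivot g k v ⊎ OddPivot g k v

YoungExists : ℕ → ℕ → Set
YoungExists g k =
  (∃ λ r → r ≢ 0 × InH g k ⟦ r , r ⟧)
  ⊎ (∃₂ λ r' r → r' ≢ r × InH g k ⟦ r' , r ⟧ × Step g k ⟦ r' , r ⟧ ⟦ r , r' ⟧)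

Kept : ℕ → ℕ → Node → Set
Kept g k v = InH g k v × ∃ λ p → Pivot g k p × Path g k v p

YEdge : ℕ → ℕ → Node → ℕ → ℕ → Node → Set
YEdge g k u c a v = Kept g k u × Kept g k v × Edge g k u c a v

module Submission where

open import Defs
open import Data.Nat using (ℕ; _≤_; _<_; _+_; _*_; _%_; NonZero; >-nonZero; z<s)
open import Data.Nat.Properties
  using (≤-trans; <-≤-trans; <⇒≤; +-cancelˡ-≡; *-cancelʳ-≡)
open import Data.Nat.DivMod using (m<n⇒m%n≡m; [m+kn]%n≡m%n)
open import Data.Integer as ℤ using (ℤ; +_)
open import Data.Integer.Properties using (+-injective; pos-+; pos-*)
open import Data.Integer.Tactic.RingSolver using (solve-∀)
open import Data.Product using (_×_; _,_; proj₁; proj₂)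
open import Data.Empty using (⊥-elim)
open import Relation.Binary.PropositionalEquality
  using (_≡_; _≢_; refl; sym; trans; cong; cong₂; module ≡-Reasoning)
open import Relation.Binary.Construct.Closure.ReflexiveTransitive using (ε; _◅_)

-- Two edges [s,r] → [t,q] and [s₁,r₁] → [t₁,q₁] with the same label (c,a)
-- give, by subtracting their defining equations,
--   g q + r₁ = g q₁ + r   and   t + s₁ g = t₁ + s g.
-- The r-coordinate of a node reached from the start and both coordinates of
-- an edge target are below k ≤ g, so uniqueness of division with remainder
-- yields r = r₁, q = q₁, t = t₁ and s = s₁.  This holds for all edges of
-- H(g,k) leaving non-starting nodes, not only those of the Young graph.

remainder-unique : ∀ {g x y q q'} → x < g → y < g →
                   x + q * g ≡ y + q' * g → x ≡ y × q ≡ q'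
remainder-unique {g} {x} {y} {q} {q'} x<g y<g e = x≡y , q≡q'
  where
  instance
    g≢0 : NonZero g
    g≢0 = >-nonZero (≤-trans z<s x<g)

  open ≡-Reasoning

  x≡y : x ≡ y
  x≡y = begin
    x               ≡⟨ sym (m<n⇒m%n≡m x<g) ⟩
    x % g           ≡⟨ sym ([m+kn]%n≡m%n x q g) ⟩
    (x + q * g) % g ≡⟨ cong (_% g) e ⟩
    (y + q' * g) % g ≡⟨ [m+kn]%n≡m%n y q' g ⟩
    y % g           ≡⟨ m<n⇒m%n≡m y<g ⟩
    y               ∎

  q≡q' : q ≡ q'
  q≡q' = *-cancelʳ-≡ q q' g (+-cancelˡ-≡ y _ _ (trans (cong (λ z → z + q * g) (sym x≡y)) e))

pos-+-* : ∀ x q g → + (x + q * g) ≡ + x ℤ.+ + q ℤ.* + g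
pos-+-* x q g = trans (pos-+ x (q * g)) (cong (ℤ._+_ (+ x)) (pos-* q g))

+-remainder-unique : ∀ {g x y} q q' → x < g → y < g →
                     + x ℤ.+ + q ℤ.* + g ≡ + y ℤ.+ + q' ℤ.* + g → x ≡ y × q ≡ q'
+-remainder-unique {g} {x} {y} q q' x<g y<g e =
  remainder-unique x<g y<g
    (+-injective (trans (pos-+-* x q g) (trans e (sym (pos-+-* y q' g)))))

cancel-offset : ∀ {x x' : ℤ} p r r' d →
                x ≡ (p ℤ.+ r) ℤ.- d → x' ≡ (p ℤ.+ r') ℤ.- d → x ℤ.+ r' ≡ x' ℤ.+ r
cancel-offset p r r' d refl refl = swap p r r' d
  where
  swap : ∀ p r r' d → ((p ℤ.+ r) ℤ.- d) ℤ.+ r' ≡ ((p ℤ.+ r') ℤ.- d) ℤ.+ r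
  swap = solve-∀

*-+-rotate : ∀ (m n x : ℤ) → m ℤ.* n ℤ.+ x ≡ x ℤ.+ n ℤ.* m
*-+-rotate = solve-∀

edge-target-r< : ∀ {g k u c a v} → Edge g k u c a v → rOf v < k
edge-target-r< (edge _ _ _ _ _ _ r'<k _) = r'<k

path-r< : ∀ {g k w v} → Path g k w v → rOf w < k → rOf v < k
path-r< ε          r<k = r<k
path-r< ((_ , _ , e) ◅ p) _ = path-r< p (edge-target-r< e)

inH-r< : ∀ {g k v} → 0 < k → InH g k v → rOf v < k
inH-r< 0<k p = path-r< p 0<k

coords-injective : ∀ {u u'} → u ≢ start → u' ≢ start →
                   sOf u ≡ sOf u' → rOf u ≡ rOf u' → u ≡ u'
coords-injective {start} u≢start _ _ _ = ⊥-elim (u≢start refl)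
coords-injective {⟦ _ , _ ⟧} {start} _ u'≢start _ _ = ⊥-elim (u'≢start refl)
coords-injective {⟦ _ , _ ⟧} {⟦ _ , _ ⟧} _ _ refl refl = refl

edge-label-determines-endpoints :
  ∀ {g k u u' v v' c a} → k ≤ g → rOf u < k → rOf u' < k →
  Edge g k u c a v → Edge g k u' c a v' →
  sOf u ≡ sOf u' × rOf u ≡ rOf u' × v ≡ v'
edge-label-determines-endpoints {g} {k} {u} {u'} {c = c} {a} k≤g r<k r'<k
  (edge {s' = t}  {r' = q}  _ _ _ es  t<k  er  _ _)
  (edge {s' = t'} {r' = q'} _ _ _ es' t'<k er' _ _) =
  sym s'≡s , sym r'≡r , cong₂ ⟦_,_⟧ t≡t' q≡q'
  where
  <g : ∀ {n} → n < k → n < g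
  <g n<k = <-≤-trans n<k k≤g

  r-relation : + rOf u' ℤ.+ + q ℤ.* + g ≡ + rOf u ℤ.+ + q' ℤ.* + g
  r-relation = trans (sym (*-+-rotate (+ g) (+ q) (+ rOf u')))
               (trans (cancel-offset (+ k ℤ.* + a) (+ rOf u) (+ rOf u') (+ c) er er')
                      (*-+-rotate (+ g) (+ q') (+ rOf u)))

  s-relation : + t ℤ.+ + sOf u' ℤ.* + g ≡ + t' ℤ.+ + sOf u ℤ.* + g
  s-relation = cancel-offset (+ a) (+ sOf u ℤ.* + g) (+ sOf u' ℤ.* + g) (+ k ℤ.* + c) es es'

  r'≡r : rOf u' ≡ rOf u
  r'≡r = proj₁ (+-remainder-unique q q' (<g r'<k) (<g r<k) r-relation)

  q≡q' : q ≡ q'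
  q≡q' = proj₂ (+-remainder-unique q q' (<g r'<k) (<g r<k) r-relation)

  t≡t' : t ≡ t'
  t≡t' = proj₁ (+-remainder-unique (sOf u') (sOf u) (<g t<k) (<g t'<k) s-relation)

  s'≡s : sOf u' ≡ sOf u
  s'≡s = proj₂ (+-remainder-unique (sOf u') (sOf u) (<g t<k) (<g t'<k) s-relation)

mainTheorem7 : (g k : ℕ) → 3 ≤ g → 2 ≤ k → k < g → YoungExists g k →
    ∀ {u v u' v' c a} → YEdge g k u c a v → YEdge g k u' c a v' →
    u ≢ start → u' ≢ start → (u ≡ u') × (v ≡ v')
mainTheorem7 g k _ 2≤k k<g _ ((u∈H , _) , _ , e) ((u'∈H , _) , _ , e') u≢start u'≢start =
  let 0<k = ≤-trans z<s 2≤k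
      s≡s' , r≡r' , v≡v' =
        edge-label-determines-endpoints (<⇒≤ k<g) (inH-r< 0<k u∈H) (inH-r< 0<k u'∈H) e e'
  in coords-injective u≢start u'≢start s≡s' r≡r' , v≡v'
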